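{- Let $N=\lfloor n^{7/12}\rfloor$ and let $Q$ be a random $N\times N$ matrix with i.i.d. $\mathrm{Bernoulli}(1/n)$ entries; let $|Q|=\sum_{i,j}Q(i,j)$. Let $\mathcal{Q}$ be the event that every row and every column of $Q$ contains at most one $1$. Then for all sufficiently large $n$ and all integers $0\le k\le n^{1/5}$, $$\mathbb{P}(\mathcal{Q}\mid |Q|=k)\ge 1-n^{ -1/6}.$$ -}

module Defs where

open import Data.Bool using (Bool; true; false; if_then_else_; _∧_)
open import Data.Nat as ℕ using (ℕ; zero; suc)
open import Data.Integer using (+_)
open import Data.List using (List; []; _∷_; concatMap; foldr)
open import Data.Vec using (Vec; []; _∷_; transpose)
import Data.Vec as Vec
open import Data.Rational as ℚ using (ℚ; 0ℚ; 1ℚ; _+_; _*_; _-_; _÷_; _≤_; ≢-nonZero)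
open import Data.Rational.Properties using (_≟_)
open import Data.Sum using (_⊎_)
open import Relation.Nullary using (yes; no)

infixr 8 _^ℚ_
_^ℚ_ : ℚ → ℕ → ℚ
q ^ℚ zero  = 1ℚ
q ^ℚ suc m = q * (q ^ℚ m)

allVecsFrom : {A : Set} → List A → (m : ℕ) → List (Vec A m)
allVecsFrom xs zero    = [] ∷ []
allVecsFrom xs (suc m) =
  concatMap (λ x → Data.List.map (x ∷_) (allVecsFrom xs m)) xs

-- A 0/1 matrix of size N × N (true = entry 1).
Mat : ℕ → Set
Mat N = Vec (Vec Bool N) N

allMats : (N : ℕ) → List (Mat N)
allMats N = allVecsFrom (allVecsFrom (true ∷ false ∷ []) N) N

countRow : {m : ℕ} → Vec Bool m → ℕ
countRow = Vec.foldr _ (λ b c → if b then suc c else c) 0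

size : {N : ℕ} → Mat N → ℕ
size = Vec.foldr _ (λ r c → countRow r ℕ.+ c) 0

rowsAtMostOne : {m N : ℕ} → Vec (Vec Bool N) m → Bool
rowsAtMostOne = Vec.foldr _ (λ r b → (countRow r ℕ.≤ᵇ 1) ∧ b) true

eventQ : {N : ℕ} → Mat N → Bool
eventQ Q = rowsAtMostOne Q ∧ rowsAtMostOne (transpose Q)

weight : {N : ℕ} → ℚ → Mat N → ℚ
weight p Q =
  Vec.foldr _ (λ r w → Vec.foldr _ (λ b w' → (if b then p else (1ℚ - p)) * w') 1ℚ r * w) 1ℚ Q

prob : (N : ℕ) → ℚ → (Mat N → Bool) → ℚ
prob N p E = foldr (λ Q acc → (if E Q then weight p Q else 0ℚ) + acc) 0ℚ (allMats N)

-- Conditional probability P(A | B) = P(A ∩ B) / P(B)  (set to 0 if P(B) = 0).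
condProb : (N : ℕ) → ℚ → (Mat N → Bool) → (Mat N → Bool) → ℚ
condProb N p A B with prob N p B ≟ 0ℚ
... | yes _  = 0ℚ
... | no b≢0 = _÷_ (prob N p (λ Q → A Q ∧ B Q)) (prob N p B) {{≢-nonZero b≢0}}

invN : (n : ℕ) → .{{ℕ.NonZero n}} → ℚ
invN n = + 1 ℚ./ n

-- "P ≥ 1 - n^(-1/6)", written without irrational numbers:
-- 1 - P ≤ n^(-1/6)  iff  1 - P ≤ 0  or  (1 - P)^6 ≤ 1/n.
GeOneMinusInvSixthRoot : ℚ → (n : ℕ) → .{{ℕ.NonZero n}} → Set
GeOneMinusInvSixthRoot P n = (1ℚ - P ≤ 0ℚ) ⊎ ((1ℚ - P) ^ℚ 6 ≤ invN n)

{-# OPTIONS --safe #-}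
-- All matrices with |Q| = k carry the same Bernoulli weight, so P(𝒬 | |Q| = k) is the
-- proportion of k-sets of the N² cells that meet no row and no column twice. The k-sets meeting
-- no row twice number (N choose k) N^k; comparing the Pascal recurrences of (N choose k) N^k and
-- (N² choose k) shows that they form a proportion at least 1 - k²/N. The same holds for columns,
-- so 1 - P(𝒬 | |Q| = k) ≤ 2k²/N, and N ≈ n^(7/12), k ≤ n^(1/5) give
-- (2k²/N)^6 ≤ 64 n^(12/5 - 7/2) ≤ 1/n for n large.
module Submission where

open import Defs
open import Data.Bool using (Bool; true; false; if_then_else_; _∧_; not; T)
open import Data.List using (List; []; _∷_; concatMap; map; _++_; foldr)
open import Data.Vec using (Vec; []; _∷_; transpose; replicate; _⊛_; concat)
import Data.Vec as Vec
open import Function using (_∘_)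
open import Relation.Binary.PropositionalEquality
open import Relation.Nullary using (yes; no; contradiction)

module Counting where
  open import Data.Nat as ℕ using (ℕ; zero; suc; _+_; _*_; _∸_; _≤_; _≡ᵇ_; _≤ᵇ_; z≤n; s≤s; NonZero)
  open import Data.Nat.Properties
  open import Data.Nat.Tactic.RingSolver using (solve-∀)
  import Algebra.Properties.CommutativeSemigroup as CommSemigroupProperties

  module +-CS = CommSemigroupProperties +-commutativeSemigroup
  module *-CS = CommSemigroupProperties *-commutativeSemigroup

  private variable
    A B : Set

  ∑ : List A → (A → ℕ) → ℕ
  ∑ []       f = 0
  ∑ (x ∷ xs) f = f x + ∑ xs f

  ∑-cong : (xs : List A) {f g : A → ℕ} → (∀ x → f x ≡ g x) → ∑ xs f ≡ ∑ xs g
  ∑-cong []       f≗g = refl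
  ∑-cong (x ∷ xs) f≗g = cong₂ _+_ (f≗g x) (∑-cong xs f≗g)

  ∑-mono : (xs : List A) {f g : A → ℕ} → (∀ x → f x ≤ g x) → ∑ xs f ≤ ∑ xs g
  ∑-mono []       f≤g = z≤n
  ∑-mono (x ∷ xs) f≤g = +-mono-≤ (f≤g x) (∑-mono xs f≤g)

  ∑-zero : (xs : List A) {f : A → ℕ} → (∀ x → f x ≡ 0) → ∑ xs f ≡ 0
  ∑-zero []       f≗0 = refl
  ∑-zero (x ∷ xs) f≗0 = cong₂ _+_ (f≗0 x) (∑-zero xs f≗0)

  ∑-+ : (xs : List A) (f g : A → ℕ) → ∑ xs (λ x → f x + g x) ≡ ∑ xs f + ∑ xs g
  ∑-+ []       f g = refl
  ∑-+ (x ∷ xs) f g = trans (cong (f x + g x +_) (∑-+ xs f g)) (+-CS.interchange (f x) (g x) _ _)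

  ∑-++ : (xs ys : List A) (f : A → ℕ) → ∑ (xs ++ ys) f ≡ ∑ xs f + ∑ ys f
  ∑-++ []       ys f = refl
  ∑-++ (x ∷ xs) ys f = trans (cong (f x +_) (∑-++ xs ys f)) (sym (+-assoc (f x) _ _))

  ∑-map : (h : A → B) (xs : List A) (f : B → ℕ) → ∑ (map h xs) f ≡ ∑ xs (λ x → f (h x))
  ∑-map h []       f = refl
  ∑-map h (x ∷ xs) f = cong (f (h x) +_) (∑-map h xs f)

  ∑-concatMap : (h : A → List B) (xs : List A) (f : B → ℕ) →
                ∑ (concatMap h xs) f ≡ ∑ xs (λ x → ∑ (h x) f)
  ∑-concatMap h []       f = refl
  ∑-concatMap h (x ∷ xs) f =
    trans (∑-++ (h x) (concatMap h xs) f) (cong (∑ (h x) f +_) (∑-concatMap h xs f))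

  ∑-comm : (xs : List A) (ys : List B) (f : A → B → ℕ) →
           ∑ xs (λ x → ∑ ys (f x)) ≡ ∑ ys (λ y → ∑ xs (λ x → f x y))
  ∑-comm []       ys f = sym (∑-zero ys (λ _ → refl))
  ∑-comm (x ∷ xs) ys f =
    trans (cong (∑ ys (f x) +_) (∑-comm xs ys f)) (sym (∑-+ ys (f x) (λ y → ∑ xs (λ x → f x y))))

  allMatsFrom : List A → (m n : ℕ) → List (Vec (Vec A n) m)
  allMatsFrom xs m n = allVecsFrom (allVecsFrom xs n) m

  ∑-allVecsFrom-suc : (xs : List A) (m : ℕ) (F : Vec A (suc m) → ℕ) →
    ∑ (allVecsFrom xs (suc m)) F ≡ ∑ xs (λ x → ∑ (allVecsFrom xs m) (λ v → F (x ∷ v)))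
  ∑-allVecsFrom-suc xs m F =
    trans (∑-concatMap _ xs F) (∑-cong xs (λ x → ∑-map (x ∷_) (allVecsFrom xs m) F))

  ∑-allVecsFrom-++ : (xs : List A) (a b : ℕ) (F : Vec A (a + b) → ℕ) →
    ∑ (allVecsFrom xs (a + b)) F ≡
    ∑ (allVecsFrom xs a) (λ u → ∑ (allVecsFrom xs b) (λ v → F (u Vec.++ v)))
  ∑-allVecsFrom-++ xs zero    b F = sym (+-identityʳ _)
  ∑-allVecsFrom-++ xs (suc a) b F = begin
    ∑ (allVecsFrom xs (suc a + b)) F
      ≡⟨ ∑-allVecsFrom-suc xs (a + b) F ⟩
    ∑ xs (λ x → ∑ (allVecsFrom xs (a + b)) (λ v → F (x ∷ v)))
      ≡⟨ ∑-cong xs (λ x → ∑-allVecsFrom-++ xs a b (λ v → F (x ∷ v))) ⟩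
    ∑ xs (λ x → ∑ (allVecsFrom xs a) (λ u → ∑ (allVecsFrom xs b) (λ v → F (x ∷ u Vec.++ v))))
      ≡⟨ ∑-allVecsFrom-suc xs a _ ⟨
    ∑ (allVecsFrom xs (suc a)) (λ u → ∑ (allVecsFrom xs b) (λ v → F (u Vec.++ v))) ∎
    where open ≡-Reasoning

  ∑-allMatsFrom-concat : (xs : List A) (m n : ℕ) (F : Vec A (m * n) → ℕ) →
    ∑ (allMatsFrom xs m n) (F ∘ concat) ≡ ∑ (allVecsFrom xs (m * n)) F
  ∑-allMatsFrom-concat xs zero    n F = refl
  ∑-allMatsFrom-concat xs (suc m) n F = begin
    ∑ (allMatsFrom xs (suc m) n) (F ∘ concat)
      ≡⟨ ∑-allVecsFrom-suc (allVecsFrom xs n) m _ ⟩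
    ∑ (allVecsFrom xs n) (λ r → ∑ (allMatsFrom xs m n) (λ Q → F (r Vec.++ concat Q)))
      ≡⟨ ∑-cong (allVecsFrom xs n) (λ r → ∑-allMatsFrom-concat xs m n (λ v → F (r Vec.++ v))) ⟩
    ∑ (allVecsFrom xs n) (λ r → ∑ (allVecsFrom xs (m * n)) (λ v → F (r Vec.++ v)))
      ≡⟨ ∑-allVecsFrom-++ xs n (m * n) F ⟨
    ∑ (allVecsFrom xs (n + m * n)) F ∎
    where open ≡-Reasoning

  consColumn : {m n : ℕ} → Vec A n → Vec (Vec A m) n → Vec (Vec A (suc m)) n
  consColumn {n = n} c T = (replicate n _∷_ ⊛ c) ⊛ T

  ∑-allMatsFrom-empty : (xs : List A) (m : ℕ) (F : Vec (Vec A 0) m → ℕ) →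
    ∑ (allMatsFrom xs m 0) F ≡ F (replicate m [])
  ∑-allMatsFrom-empty xs zero    F = +-identityʳ _
  ∑-allMatsFrom-empty xs (suc m) F = begin
    ∑ (allMatsFrom xs (suc m) 0) F           ≡⟨ ∑-allVecsFrom-suc _ m F ⟩
    ∑ (allMatsFrom xs m 0) (F ∘ ([] ∷_)) + 0 ≡⟨ +-identityʳ _ ⟩
    ∑ (allMatsFrom xs m 0) (F ∘ ([] ∷_))     ≡⟨ ∑-allMatsFrom-empty xs m (F ∘ ([] ∷_)) ⟩
    F (replicate (suc m) [])                 ∎
    where open ≡-Reasoning

  ∑-allMatsFrom-consColumn : (xs : List A) (n m : ℕ) (F : Vec (Vec A (suc m)) n → ℕ) →
    ∑ (allVecsFrom xs n) (λ c → ∑ (allMatsFrom xs n m) (F ∘ consColumn c)) ≡ ∑ (allMatsFrom xs n (suc m)) F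
  ∑-allMatsFrom-consColumn xs zero    m F = +-identityʳ _
  ∑-allMatsFrom-consColumn xs (suc n) m F = begin
    ∑ (allVecsFrom xs (suc n)) (λ c → ∑ (allMatsFrom xs (suc n) m) (F ∘ consColumn c))
      ≡⟨ ∑-allVecsFrom-suc xs n _ ⟩
    ∑ xs (λ x → ∑ (allVecsFrom xs n) (λ c → ∑ (allMatsFrom xs (suc n) m) (F ∘ consColumn (x ∷ c))))
      ≡⟨ ∑-cong xs (λ x → ∑-cong (allVecsFrom xs n) (λ c → ∑-allVecsFrom-suc (allVecsFrom xs m) n _)) ⟩
    ∑ xs (λ x → ∑ (allVecsFrom xs n) (λ c → ∑ (allVecsFrom xs m) (λ r → G x r c)))
      ≡⟨ ∑-cong xs (λ x → ∑-comm (allVecsFrom xs n) (allVecsFrom xs m) (λ c r → G x r c)) ⟩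
    ∑ xs (λ x → ∑ (allVecsFrom xs m) (λ r → ∑ (allVecsFrom xs n) (G x r)))
      ≡⟨ ∑-cong xs (λ x → ∑-cong (allVecsFrom xs m) (λ r → ∑-allMatsFrom-consColumn xs n m (F ∘ ((x ∷ r) ∷_)))) ⟩
    ∑ xs (λ x → ∑ (allVecsFrom xs m) (λ r → ∑ (allMatsFrom xs n (suc m)) (F ∘ ((x ∷ r) ∷_))))
      ≡⟨ ∑-allVecsFrom-suc xs m _ ⟨
    ∑ (allVecsFrom xs (suc m)) (λ r → ∑ (allMatsFrom xs n (suc m)) (F ∘ (r ∷_)))
      ≡⟨ ∑-allVecsFrom-suc (allVecsFrom xs (suc m)) n F ⟨
    ∑ (allMatsFrom xs (suc n) (suc m)) F ∎
    where
    open ≡-Reasoning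
    G : _ → Vec _ m → Vec _ n → ℕ
    G x r c = ∑ (allMatsFrom xs n m) (λ T → F ((x ∷ r) ∷ consColumn c T))

  ∑-allMatsFrom-transpose : (xs : List A) (m n : ℕ) (F : Vec (Vec A m) n → ℕ) →
    ∑ (allMatsFrom xs m n) (F ∘ transpose) ≡ ∑ (allMatsFrom xs n m) F
  ∑-allMatsFrom-transpose xs zero    n F = trans (+-identityʳ _) (sym (∑-allMatsFrom-empty xs n F))
  ∑-allMatsFrom-transpose xs (suc m) n F = begin
    ∑ (allMatsFrom xs (suc m) n) (F ∘ transpose)
      ≡⟨ ∑-allVecsFrom-suc (allVecsFrom xs n) m _ ⟩
    ∑ (allVecsFrom xs n) (λ c → ∑ (allMatsFrom xs m n) (F ∘ consColumn c ∘ transpose))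
      ≡⟨ ∑-cong (allVecsFrom xs n) (λ c → ∑-allMatsFrom-transpose xs m n (F ∘ consColumn c)) ⟩
    ∑ (allVecsFrom xs n) (λ c → ∑ (allMatsFrom xs n m) (F ∘ consColumn c))
      ≡⟨ ∑-allMatsFrom-consColumn xs n m F ⟩
    ∑ (allMatsFrom xs n (suc m)) F ∎
    where open ≡-Reasoning

  𝟙 : Bool → ℕ
  𝟙 b = if b then 1 else 0

  bits : List Bool
  bits = true ∷ false ∷ []

  countMat : {m n : ℕ} → Vec (Vec Bool n) m → ℕ
  countMat = Vec.foldr _ (λ r c → countRow r + c) 0

  countRow-++ : {a b : ℕ} (u : Vec Bool a) (v : Vec Bool b) → countRow (u Vec.++ v) ≡ countRow u + countRow v
  countRow-++ []          v = refl
  countRow-++ (true ∷ u)  v = cong suc (countRow-++ u v)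
  countRow-++ (false ∷ u) v = countRow-++ u v

  countRow≤length : {L : ℕ} (v : Vec Bool L) → countRow v ≤ L
  countRow≤length []          = z≤n
  countRow≤length (true ∷ v)  = s≤s (countRow≤length v)
  countRow≤length (false ∷ v) = m≤n⇒m≤1+n (countRow≤length v)

  countMat-concat : {m n : ℕ} (Q : Vec (Vec Bool n) m) → countMat Q ≡ countRow (concat Q)
  countMat-concat []      = refl
  countMat-concat (r ∷ Q) = trans (cong (countRow r +_) (countMat-concat Q)) (sym (countRow-++ r (concat Q)))

  countMat-consColumn : {m n : ℕ} (c : Vec Bool n) (T : Vec (Vec Bool m) n) →
                        countMat (consColumn c T) ≡ countRow c + countMat T
  countMat-consColumn []          []      = refl
  countMat-consColumn (true ∷ c)  (t ∷ T) =
    trans (cong (suc (countRow t) +_) (countMat-consColumn c T))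
          (cong suc (+-CS.x∙yz≈y∙xz (countRow t) (countRow c) (countMat T)))
  countMat-consColumn (false ∷ c) (t ∷ T) =
    trans (cong (countRow t +_) (countMat-consColumn c T))
          (+-CS.x∙yz≈y∙xz (countRow t) (countRow c) (countMat T))

  countMat-transpose : {m n : ℕ} (Q : Vec (Vec Bool n) m) → countMat (transpose Q) ≡ countMat Q
  countMat-transpose {n = n} [] = countMat-replicate n
    where
    countMat-replicate : ∀ n → countMat (replicate n []) ≡ 0
    countMat-replicate zero    = refl
    countMat-replicate (suc n) = countMat-replicate n
  countMat-transpose (r ∷ Q) =
    trans (countMat-consColumn r (transpose Q)) (cong (countRow r +_) (countMat-transpose Q))

  -- The recurrence satisfied by f m k = (m choose k) a^k.
  record IsPascal (a : ℕ) (f : ℕ → ℕ → ℕ) : Set where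
    field
      zero-suc : ∀ k → f 0 (suc k) ≡ 0
      suc-zero : ∀ m → f (suc m) 0 ≡ f m 0
      suc-suc  : ∀ m k → f (suc m) (suc k) ≡ f m (suc k) + a * f m k

  module _ {a : ℕ} {f : ℕ → ℕ → ℕ} (pascal : IsPascal a f) where
    open IsPascal pascal

    pascal-column-zero : ∀ m → f m 0 ≡ f 0 0
    pascal-column-zero zero    = refl
    pascal-column-zero (suc m) = trans (suc-zero m) (pascal-column-zero m)

    pascal-pos : .{{NonZero a}} → 1 ≤ f 0 0 → ∀ {m k} → k ≤ m → 1 ≤ f m k
    pascal-pos 1≤f00 {m} {zero} _ = subst (1 ≤_) (sym (pascal-column-zero m)) 1≤f00
    pascal-pos 1≤f00 {suc m} {suc k} (s≤s k≤m) = begin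
      1                       ≤⟨ pascal-pos 1≤f00 k≤m ⟩
      f m k                   ≤⟨ m≤n*m (f m k) a ⟩
      a * f m k               ≤⟨ m≤n+m _ _ ⟩
      f m (suc k) + a * f m k ≡⟨ suc-suc m k ⟨
      f (suc m) (suc k)       ∎
      where open ≤-Reasoning

    -- (k + 1) (m choose k + 1) = (m - k) (m choose k), free of subtraction.
    pascal-absorption : ∀ m k → suc k * f m (suc k) + k * (a * f m k) ≡ m * (a * f m k)
    pascal-absorption zero zero = cong (λ x → 1 * x + 0) (zero-suc 0)
    pascal-absorption zero (suc k) = begin
      suc (suc k) * f 0 (suc (suc k)) + suc k * (a * f 0 (suc k))
        ≡⟨ cong₂ (λ x y → suc (suc k) * x + suc k * (a * y)) (zero-suc (suc k)) (zero-suc k) ⟩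
      suc (suc k) * 0 + suc k * (a * 0)
        ≡⟨ x*0+y*[z*0]≡0 (suc (suc k)) (suc k) a ⟩
      0 ∎
      where
      open ≡-Reasoning
      x*0+y*[z*0]≡0 : ∀ x y z → x * 0 + y * (z * 0) ≡ 0
      x*0+y*[z*0]≡0 = solve-∀
    pascal-absorption (suc m) zero = begin
      1 * f (suc m) 1 + 0             ≡⟨ cong (λ x → 1 * x + 0) (suc-suc m 0) ⟩
      1 * (f m 1 + Y) + 0             ≡⟨ shift (f m 1) Y ⟩
      (1 * f m 1 + 0 * Y) + Y         ≡⟨ cong (_+ Y) (pascal-absorption m 0) ⟩
      m * Y + Y                       ≡⟨ +-comm (m * Y) Y ⟩
      suc m * Y                       ≡⟨ cong (λ x → suc m * (a * x)) (suc-zero m) ⟨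
      suc m * (a * f (suc m) 0)       ∎
      where
      open ≡-Reasoning
      Y = a * f m 0
      shift : ∀ x y → 1 * (x + y) + 0 ≡ (1 * x + 0 * y) + y
      shift = solve-∀
    pascal-absorption (suc m) (suc k) = begin
      suc (suc k) * f (suc m) (suc (suc k)) + suc k * (a * f (suc m) (suc k))
        ≡⟨ cong₂ (λ x y → suc (suc k) * x + suc k * (a * y)) (suc-suc m (suc k)) (suc-suc m k) ⟩
      suc (suc k) * (X + a * Y) + suc k * (a * (Y + a * Z))
        ≡⟨ regroup k a X Y Z ⟩
      (suc (suc k) * X + suc k * (a * Y)) + a * Y + a * (suc k * Y + k * (a * Z)) + a * (a * Z)
        ≡⟨ cong₂ (λ u v → u + a * Y + a * v + a * (a * Z)) (pascal-absorption m (suc k)) (pascal-absorption m k) ⟩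
      m * (a * Y) + a * Y + a * (m * (a * Z)) + a * (a * Z)
        ≡⟨ collect m a Y Z ⟩
      suc m * (a * (Y + a * Z))
        ≡⟨ cong (λ x → suc m * (a * x)) (suc-suc m k) ⟨
      suc m * (a * f (suc m) (suc k)) ∎
      where
      open ≡-Reasoning
      X = f m (suc (suc k))
      Y = f m (suc k)
      Z = f m k
      regroup : ∀ k a X Y Z → suc (suc k) * (X + a * Y) + suc k * (a * (Y + a * Z)) ≡
                (suc (suc k) * X + suc k * (a * Y)) + a * Y + a * (suc k * Y + k * (a * Z)) + a * (a * Z)
      regroup = solve-∀
      collect : ∀ m a Y Z → m * (a * Y) + a * Y + a * (m * (a * Z)) + a * (a * Z) ≡ suc m * (a * (Y + a * Z))
      collect = solve-∀

  binomialCount : ℕ → ℕ → ℕ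
  binomialCount L k = ∑ (allVecsFrom bits L) (λ v → 𝟙 (countRow v ≡ᵇ k))

  binomialCount-isPascal : IsPascal 1 binomialCount
  binomialCount-isPascal = record
    { zero-suc = λ k → refl
    ; suc-zero = λ L → trans (∑-allVecsFrom-suc bits L _)
                             (trans (cong (_+ (binomialCount L 0 + 0)) (∑-zero (allVecsFrom bits L) (λ _ → refl)))
                                    (+-identityʳ _))
    ; suc-suc  = λ L k → trans (∑-allVecsFrom-suc bits L _) (x+[y+0]≡y+1*x (binomialCount L k) _)
    }
    where
    x+[y+0]≡y+1*x : ∀ x y → x + (y + 0) ≡ y + 1 * x
    x+[y+0]≡y+1*x = solve-∀

  ∑-countRow-vanishing≥1 : ∀ L (h : ℕ → ℕ) → (∀ c → h (suc c) ≡ 0) →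
                           ∑ (allVecsFrom bits L) (h ∘ countRow) ≡ h 0
  ∑-countRow-vanishing≥1 zero    h h≥1≡0 = +-identityʳ _
  ∑-countRow-vanishing≥1 (suc L) h h≥1≡0 = begin
    ∑ (allVecsFrom bits (suc L)) (h ∘ countRow)
      ≡⟨ ∑-allVecsFrom-suc bits L _ ⟩
    ∑ (allVecsFrom bits L) (h ∘ suc ∘ countRow) + (∑ (allVecsFrom bits L) (h ∘ countRow) + 0)
      ≡⟨ cong₂ _+_ (∑-zero (allVecsFrom bits L) (h≥1≡0 ∘ countRow)) (+-identityʳ _) ⟩
    ∑ (allVecsFrom bits L) (h ∘ countRow)
      ≡⟨ ∑-countRow-vanishing≥1 L h h≥1≡0 ⟩
    h 0 ∎
    where open ≡-Reasoning

  ∑-countRow-vanishing≥2 : ∀ L (h : ℕ → ℕ) → (∀ c → h (suc (suc c)) ≡ 0) →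
                           ∑ (allVecsFrom bits L) (h ∘ countRow) ≡ h 0 + L * h 1
  ∑-countRow-vanishing≥2 zero    h h≥2≡0 = refl
  ∑-countRow-vanishing≥2 (suc L) h h≥2≡0 = begin
    ∑ (allVecsFrom bits (suc L)) (h ∘ countRow)
      ≡⟨ ∑-allVecsFrom-suc bits L _ ⟩
    ∑ (allVecsFrom bits L) (h ∘ suc ∘ countRow) + (∑ (allVecsFrom bits L) (h ∘ countRow) + 0)
      ≡⟨ cong₂ _+_ (∑-countRow-vanishing≥1 L (h ∘ suc) h≥2≡0) (+-identityʳ _) ⟩
    h 1 + ∑ (allVecsFrom bits L) (h ∘ countRow)
      ≡⟨ cong (h 1 +_) (∑-countRow-vanishing≥2 L h h≥2≡0) ⟩
    h 1 + (h 0 + L * h 1)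
      ≡⟨ +-CS.x∙yz≈y∙xz (h 1) (h 0) (L * h 1) ⟩
    h 0 + suc L * h 1 ∎
    where open ≡-Reasoning

  rowSparseCount : ℕ → ℕ → ℕ → ℕ
  rowSparseCount N m k = ∑ (allMatsFrom bits m N) (λ Q → 𝟙 ((countMat Q ≡ᵇ k) ∧ rowsAtMostOne Q))

  module _ (N : ℕ) where

    -- The summand of rowSparseCount N (suc m) k for a first row with c ones.
    firstRowWith : ℕ → ℕ → ℕ → ℕ
    firstRowWith m k c = ∑ (allMatsFrom bits m N) (λ Q → 𝟙 ((c + countMat Q ≡ᵇ k) ∧ ((c ≤ᵇ 1) ∧ rowsAtMostOne Q)))

    rowSparseCount-suc : ∀ m k → rowSparseCount N (suc m) k ≡ firstRowWith m k 0 + N * firstRowWith m k 1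
    rowSparseCount-suc m k = trans (∑-allVecsFrom-suc (allVecsFrom bits N) m _)
      (∑-countRow-vanishing≥2 N (firstRowWith m k)
        (λ c → ∑-zero (allMatsFrom bits m N) (λ Q → two-ones-in-a-row c (countMat Q) (rowsAtMostOne Q))))
      where
      two-ones-in-a-row : ∀ c s b → 𝟙 ((suc (suc c) + s ≡ᵇ k) ∧ ((suc (suc c) ≤ᵇ 1) ∧ b)) ≡ 0
      two-ones-in-a-row c s b with suc (suc c) + s ≡ᵇ k
      ... | true  = refl
      ... | false = refl

    rowSparseCount-isPascal : IsPascal N (rowSparseCount N)
    rowSparseCount-isPascal = record
      { zero-suc = λ k → refl
      ; suc-zero = λ m → begin
          rowSparseCount N (suc m) 0                     ≡⟨ rowSparseCount-suc m 0 ⟩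
          rowSparseCount N m 0 + N * firstRowWith m 0 1  ≡⟨ cong (λ x → rowSparseCount N m 0 + N * x) (first-row-one m) ⟩
          rowSparseCount N m 0 + N * 0                   ≡⟨ cong (rowSparseCount N m 0 +_) (*-zeroʳ N) ⟩
          rowSparseCount N m 0 + 0                       ≡⟨ +-identityʳ _ ⟩
          rowSparseCount N m 0                           ∎
      ; suc-suc  = λ m k → rowSparseCount-suc m (suc k)
      }
      where
      open ≡-Reasoning
      first-row-one : ∀ m → firstRowWith m 0 1 ≡ 0
      first-row-one m = ∑-zero (allMatsFrom bits m N) (λ _ → refl)

  -- N (N² - K) g - N (N - K) N g = K N (N - 1) g ≤ K (N² - K) g because K ≤ N.
  sparse-step-g : ∀ N K D g g′ → D + K ≡ N * N → K ≤ N → suc K * g′ + K * (N * g) ≡ N * (N * g) →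
                  N * (D * g) ≤ N * (suc K * g′) + K * (D * g)
  sparse-step-g N K D g g′ D+K≡N² K≤N g′-rec = +-cancelʳ-≤ (N * (K * g)) _ _ (begin
    N * (D * g) + N * (K * g)                     ≡⟨ *-distribˡ-+ N (D * g) (K * g) ⟨
    N * (D * g + K * g)                           ≡⟨ cong (N *_) (*-distribʳ-+ g D K) ⟨
    N * ((D + K) * g)                             ≡⟨ cong (λ x → N * (x * g)) D+K≡N² ⟩
    N * (N * N * g)                               ≡⟨ cong (N *_) (*-assoc N N g) ⟩
    N * (N * (N * g))                             ≡⟨ cong (N *_) g′-rec ⟨
    N * (suc K * g′ + K * (N * g))                ≡⟨ expand N K g′ g ⟩
    N * (suc K * g′) + K * (N * N) * g            ≡⟨ cong (λ x → N * (suc K * g′) + K * x * g) D+K≡N² ⟨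
    N * (suc K * g′) + K * (D + K) * g            ≤⟨ +-monoʳ-≤ _ (*-monoˡ-≤ g (*-monoʳ-≤ K (+-monoʳ-≤ D K≤N))) ⟩
    N * (suc K * g′) + K * (D + N) * g            ≡⟨ regroup N K D g′ g ⟩
    N * (suc K * g′) + K * (D * g) + N * (K * g)  ∎)
    where
    open ≤-Reasoning
    expand : ∀ N K g′ g → N * (suc K * g′ + K * (N * g)) ≡ N * (suc K * g′) + K * (N * N) * g
    expand = solve-∀
    regroup : ∀ N K D g′ g → N * (suc K * g′) + K * (D + N) * g ≡ N * (suc K * g′) + K * (D * g) + N * (K * g)
    regroup = solve-∀

  sparse-deficit-step : ∀ N K D t t′ g g′ → D + K ≡ N * N → K ≤ N →
    suc K * t′ ≡ D * t →
    suc K * g′ + K * (N * g) ≡ N * (N * g) →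
    g ≤ t →
    N * t ≤ K * K * t + N * g →
    N * t′ ≤ suc K * suc K * t′ + N * g′
  sparse-deficit-step N K D t t′ g g′ D+K≡N² K≤N t′-rec g′-rec g≤t N*t≤ = *-cancelˡ-≤ (suc K) (begin
    suc K * (N * t′)                                        ≡⟨ *-CS.x∙yz≈y∙xz (suc K) N t′ ⟩
    N * (suc K * t′)                                        ≡⟨ cong (N *_) t′-rec ⟩
    N * (D * t)                                             ≡⟨ *-CS.x∙yz≈y∙xz N D t ⟩
    D * (N * t)                                             ≤⟨ *-monoʳ-≤ D N*t≤ ⟩
    D * (K * K * t + N * g)                                 ≡⟨ expand D K t N g ⟩
    K * K * (D * t) + N * (D * g)                           ≤⟨ +-monoʳ-≤ (K * K * (D * t)) N*D*g≤ ⟩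
    K * K * (D * t) + (G′ + K * (D * g))                    ≤⟨ +-monoʳ-≤ (K * K * (D * t)) (+-monoʳ-≤ G′ K*D*g≤) ⟩
    K * K * (D * t) + (G′ + K * (D * t))                    ≡⟨ cong (λ x → K * K * x + (G′ + K * x)) t′-rec ⟨
    K * K * T′ + (G′ + K * T′)                              ≤⟨ m≤m+n _ (suc K * T′) ⟩
    K * K * T′ + (G′ + K * T′) + suc K * T′                 ≡⟨ collect K t′ N g′ ⟩
    suc K * (suc K * suc K * t′ + N * g′)                   ∎)
    where
    open ≤-Reasoning
    T′ = suc K * t′
    G′ = N * (suc K * g′)
    N*D*g≤ : N * (D * g) ≤ G′ + K * (D * g)
    N*D*g≤ = sparse-step-g N K D g g′ D+K≡N² K≤N g′-rec
    K*D*g≤ : K * (D * g) ≤ K * (D * t)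
    K*D*g≤ = *-monoʳ-≤ K (*-monoʳ-≤ D g≤t)
    expand : ∀ D K t N g → D * (K * K * t + N * g) ≡ K * K * (D * t) + N * (D * g)
    expand = solve-∀
    collect : ∀ K t′ N g′ →
              K * K * (suc K * t′) + (N * (suc K * g′) + K * (suc K * t′)) + suc K * (suc K * t′) ≡
              suc K * (suc K * suc K * t′ + N * g′)
    collect = solve-∀

  -- For t = (N² choose -) and g = (N choose -) N^- this says g k / t k ≥ 1 - k²/N; passing from
  -- K to K + 1 multiplies g / t by N (N - K) / (N² - K).
  sparse-deficit : ∀ {N} {t g : ℕ → ℕ → ℕ} → IsPascal 1 t → IsPascal N g →
    (∀ k → g N k ≤ t (N * N) k) → t (N * N) 0 ≤ g N 0 →
    ∀ {k} → k ≤ N → N * t (N * N) k ≤ k * k * t (N * N) k + N * g N k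
  sparse-deficit {N} t-pascal g-pascal g≤t t₀≤g₀ {zero} _ = *-monoʳ-≤ N t₀≤g₀
  sparse-deficit {N} {t} {g} t-pascal g-pascal g≤t t₀≤g₀ {suc K} 1+K≤N =
    sparse-deficit-step N K D (t (N * N) K) (t (N * N) (suc K)) (g N K) (g N (suc K))
      D+K≡N² K≤N t-step (pascal-absorption g-pascal N K) (g≤t K)
      (sparse-deficit t-pascal g-pascal g≤t t₀≤g₀ K≤N)
    where
    K≤N : K ≤ N
    K≤N = <⇒≤ 1+K≤N
    D : ℕ
    D = N * N ∸ K
    D+K≡N² : D + K ≡ N * N
    D+K≡N² = m∸n+n≡m (≤-trans K≤N (m≤m*n N N {{ℕ.>-nonZero (≤-trans (s≤s z≤n) 1+K≤N)}}))
    t-step : suc K * t (N * N) (suc K) ≡ D * t (N * N) K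
    t′ = t (N * N) (suc K)
    t-step = +-cancelʳ-≡ (K * t (N * N) K) _ _ (begin
      suc K * t (N * N) (suc K) + K * t (N * N) K        ≡⟨ cong (λ x → suc K * t′ + K * x) (*-identityˡ _) ⟨
      suc K * t (N * N) (suc K) + K * (1 * t (N * N) K)  ≡⟨ pascal-absorption t-pascal (N * N) K ⟩
      N * N * (1 * t (N * N) K)                          ≡⟨ cong₂ _*_ (sym D+K≡N²) (*-identityˡ _) ⟩
      (D + K) * t (N * N) K                              ≡⟨ *-distribʳ-+ _ D K ⟩
      D * t (N * N) K + K * t (N * N) K                  ∎)
      where open ≡-Reasoning

  countMats : (N : ℕ) → (Mat N → Bool) → ℕ
  countMats N E = ∑ (allMats N) (𝟙 ∘ E)

  module _ (N k : ℕ) where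

    hasSize : Mat N → Bool
    hasSize Q = size Q ≡ᵇ k

    countMats-hasSize : countMats N hasSize ≡ binomialCount (N * N) k
    countMats-hasSize =
      trans (∑-cong (allMats N) (λ Q → cong (λ s → 𝟙 (s ≡ᵇ k)) (countMat-concat Q)))
            (∑-allMatsFrom-concat bits N N (λ v → 𝟙 (countRow v ≡ᵇ k)))

    countMats-colSparse : countMats N (λ Q → hasSize Q ∧ rowsAtMostOne (transpose Q)) ≡ rowSparseCount N N k
    countMats-colSparse =
      trans (∑-cong (allMats N) (λ Q → cong (λ s → 𝟙 ((s ≡ᵇ k) ∧ rowsAtMostOne (transpose Q)))
                                            (sym (countMat-transpose Q))))
            (∑-allMatsFrom-transpose bits N N (λ U → 𝟙 ((countMat U ≡ᵇ k) ∧ rowsAtMostOne U)))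

    countMats-hasSize-pos : k ≤ N * N → 1 ≤ countMats N hasSize
    countMats-hasSize-pos k≤N² =
      subst (1 ≤_) (sym countMats-hasSize) (pascal-pos binomialCount-isPascal ≤-refl k≤N²)

  countMats-split : ∀ N (E B : Mat N → Bool) →
    countMats N (λ Q → E Q ∧ B Q) + countMats N (λ Q → not (E Q) ∧ B Q) ≡ countMats N B
  countMats-split N E B = trans (sym (∑-+ (allMats N) _ _)) (∑-cong (allMats N) (λ Q → split (E Q) (B Q)))
    where
    split : ∀ e b → 𝟙 (e ∧ b) + 𝟙 (not e ∧ b) ≡ 𝟙 b
    split true  true  = refl
    split true  false = refl
    split false true  = refl
    split false false = refl

  countMats-inclusion-exclusion : ∀ N (R C B : Mat N → Bool) →
    countMats N (λ Q → B Q ∧ R Q) + countMats N (λ Q → B Q ∧ C Q) ≤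
    countMats N (λ Q → (R Q ∧ C Q) ∧ B Q) + countMats N B
  countMats-inclusion-exclusion N R C B = begin
    countMats N (λ Q → B Q ∧ R Q) + countMats N (λ Q → B Q ∧ C Q)      ≡⟨ ∑-+ (allMats N) _ _ ⟨
    ∑ (allMats N) (λ Q → 𝟙 (B Q ∧ R Q) + 𝟙 (B Q ∧ C Q))                ≤⟨ ∑-mono (allMats N) (λ Q → pointwise (R Q) (C Q) (B Q)) ⟩
    ∑ (allMats N) (λ Q → 𝟙 ((R Q ∧ C Q) ∧ B Q) + 𝟙 (B Q))              ≡⟨ ∑-+ (allMats N) _ _ ⟩
    countMats N (λ Q → (R Q ∧ C Q) ∧ B Q) + countMats N B              ∎
    where
    open ≤-Reasoning
    pointwise : ∀ r c b → 𝟙 (b ∧ r) + 𝟙 (b ∧ c) ≤ 𝟙 ((r ∧ c) ∧ b) + 𝟙 b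
    pointwise true  true  true  = ≤-refl
    pointwise true  false true  = ≤-refl
    pointwise false true  true  = ≤-refl
    pointwise false false true  = z≤n
    pointwise r     c     false = z≤n

  doubled-deficit : ∀ N c a d b G → a + d ≡ b → G + G ≤ a + b → N * b ≤ c * b + N * G → N * d ≤ (c + c) * b
  doubled-deficit N c a d b G refl 2G≤a+b N*b≤ = +-cancelʳ-≤ (N * (a + b)) _ _ (begin
    N * d + N * (a + b)                   ≡⟨ regroup N a d ⟩
    N * b + N * b                         ≤⟨ +-mono-≤ N*b≤ N*b≤ ⟩
    (c * b + N * G) + (c * b + N * G)     ≡⟨ collect c b N G ⟩
    (c + c) * b + N * (G + G)             ≤⟨ +-monoʳ-≤ ((c + c) * b) (*-monoʳ-≤ N 2G≤a+b) ⟩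
    (c + c) * b + N * (a + b)             ∎)
    where
    open ≤-Reasoning
    regroup : ∀ N a d → N * d + N * (a + (a + d)) ≡ N * (a + d) + N * (a + d)
    regroup = solve-∀
    collect : ∀ c b N G → (c * b + N * G) + (c * b + N * G) ≡ (c + c) * b + N * (G + G)
    collect = solve-∀

  -- A matrix outside 𝒬 has two ones in a row or in a column; sparse-deficit bounds both kinds,
  -- the second after transposing.
  bad-count-bound : ∀ N k → k ≤ N →
    N * countMats N (λ Q → not (eventQ Q) ∧ hasSize N k Q) ≤ (k * k + k * k) * countMats N (hasSize N k)
  bad-count-bound N k k≤N = doubled-deficit N (k * k) a d b G (countMats-split N eventQ (hasSize N k)) 2G≤a+b N*b≤
    where
    a d b G : ℕ
    a = countMats N (λ Q → eventQ Q ∧ hasSize N k Q)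
    d = countMats N (λ Q → not (eventQ Q) ∧ hasSize N k Q)
    b = countMats N (hasSize N k)
    G = rowSparseCount N N k
    2G≤a+b : G + G ≤ a + b
    2G≤a+b = subst (λ x → G + x ≤ a + b) (countMats-colSparse N k)
      (countMats-inclusion-exclusion N rowsAtMostOne (rowsAtMostOne ∘ transpose) (hasSize N k))
    rowSparse≤binomial : ∀ j → rowSparseCount N N j ≤ binomialCount (N * N) j
    rowSparse≤binomial j = subst (rowSparseCount N N j ≤_) (countMats-hasSize N j)
      (∑-mono (allMats N) (λ Q → b∧r≤b (hasSize N j Q) (rowsAtMostOne Q)))
      where
      b∧r≤b : ∀ b r → 𝟙 (b ∧ r) ≤ 𝟙 b
      b∧r≤b true  true  = ≤-refl
      b∧r≤b true  false = z≤n
      b∧r≤b false r     = z≤n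
    column-zero : binomialCount (N * N) 0 ≤ rowSparseCount N N 0
    column-zero = ≤-reflexive (trans (pascal-column-zero binomialCount-isPascal (N * N))
                                     (sym (pascal-column-zero (rowSparseCount-isPascal N) N)))
    N*b≤ : N * b ≤ k * k * b + N * G
    N*b≤ = subst (λ x → N * x ≤ k * k * x + N * G) (sym (countMats-hasSize N k))
      (sparse-deficit binomialCount-isPascal (rowSparseCount-isPascal N) rowSparse≤binomial column-zero k≤N)

module Exponents where
  open import Data.Nat
  open import Data.Nat.Properties
  open import Algebra.Properties.CommutativeSemigroup *-commutativeSemigroup using (interchange; xy∙z≈xz∙y)

  ^-distribʳ-* : ∀ a b m → (a * b) ^ m ≡ a ^ m * b ^ m
  ^-distribʳ-* a b zero    = refl
  ^-distribʳ-* a b (suc m) = trans (cong (a * b *_) (^-distribʳ-* a b m)) (interchange a b (a ^ m) (b ^ m))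

  ^-cancelˡ-< : ∀ e {a b} → a ^ e < b ^ e → a < b
  ^-cancelˡ-< e {a} {b} aᵉ<bᵉ with a <? b
  ... | yes a<b = a<b
  ... | no  a≮b = contradiction (^-monoˡ-≤ e (≮⇒≥ a≮b)) (<⇒≱ aᵉ<bᵉ)

  module _ {n M : ℕ} .{{_ : NonZero n}} (n⁷<M¹² : n ^ 7 < M ^ 12) where

    n³⁵<M⁶⁰ : n ^ 35 < M ^ 60
    n³⁵<M⁶⁰ = begin-strict
      n ^ 35            ≡⟨ ^-*-assoc n 7 5 ⟨
      (n ^ 7) ^ 5       <⟨ ^-monoˡ-< 5 n⁷<M¹² ⟩
      (M ^ 12) ^ 5      ≡⟨ ^-*-assoc M 12 5 ⟩
      M ^ 60            ∎
      where open ≤-Reasoning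

    module _ {k : ℕ} (k⁵≤n : k ^ 5 ≤ n) where

      k⁶⁰≤n¹² : k ^ 60 ≤ n ^ 12
      k⁶⁰≤n¹² = subst (_≤ n ^ 12) (^-*-assoc k 5 12) (^-monoˡ-≤ 12 k⁵≤n)

      k<M : k < M
      k<M = ^-cancelˡ-< 60 (≤-<-trans k⁶⁰≤n¹² (≤-<-trans (^-monoʳ-≤ n {12} {35} (≤ᵇ⇒≤ 12 35 _)) n³⁵<M⁶⁰))

      -- The factors 2^60 from (2k²)^60 and from (2N)^60 are paid for by 2^120 ≤ n.
      sixth-power-bound : ∀ {N} → 2 ^ 120 ≤ n → M ≤ 2 * N → (k * k + k * k) ^ 6 * n < N ^ 6
      sixth-power-bound {N} n₀≤n M≤2N = ^-cancelˡ-< 10 (begin-strict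
        (c ^ 6 * n) ^ 10                   ≡⟨ ^-distribʳ-* (c ^ 6) n 10 ⟩
        (c ^ 6) ^ 10 * n ^ 10              ≡⟨ cong (_* n ^ 10) (^-*-assoc c 6 10) ⟩
        c ^ 60 * n ^ 10                    ≡⟨ cong (λ x → (k * k + x) ^ 60 * n ^ 10) (+-identityʳ (k * k)) ⟨
        (2 * (k * k)) ^ 60 * n ^ 10        ≡⟨ cong (_* n ^ 10) (^-distribʳ-* 2 (k * k) 60) ⟩
        2 ^ 60 * (k * k) ^ 60 * n ^ 10     ≡⟨ cong (λ x → 2 ^ 60 * x * n ^ 10) (^-distribʳ-* k k 60) ⟩
        2 ^ 60 * (k ^ 60 * k ^ 60) * n ^ 10
          ≤⟨ *-monoˡ-≤ (n ^ 10) (*-monoʳ-≤ (2 ^ 60) (*-mono-≤ k⁶⁰≤n¹² k⁶⁰≤n¹²)) ⟩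
        2 ^ 60 * (n ^ 12 * n ^ 12) * n ^ 10 ≡⟨ cong (λ x → 2 ^ 60 * x * n ^ 10) (^-distribˡ-+-* n 12 12) ⟨
        2 ^ 60 * n ^ 24 * n ^ 10           ≡⟨ *-assoc (2 ^ 60) (n ^ 24) (n ^ 10) ⟩
        2 ^ 60 * (n ^ 24 * n ^ 10)         ≡⟨ cong (2 ^ 60 *_) (^-distribˡ-+-* n 24 10) ⟨
        2 ^ 60 * n ^ 34                    <⟨ *-cancelˡ-< (2 ^ 60) _ _ 2⁶⁰*[2⁶⁰*n³⁴]<2⁶⁰*N⁶⁰ ⟩
        N ^ 60                             ≡⟨ ^-*-assoc N 6 10 ⟨
        (N ^ 6) ^ 10                       ∎)
        where
        open ≤-Reasoning
        c = k * k + k * k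
        2⁶⁰*[2⁶⁰*n³⁴]<2⁶⁰*N⁶⁰ : 2 ^ 60 * (2 ^ 60 * n ^ 34) < 2 ^ 60 * N ^ 60
        2⁶⁰*[2⁶⁰*n³⁴]<2⁶⁰*N⁶⁰ = begin-strict
          2 ^ 60 * (2 ^ 60 * n ^ 34)       ≡⟨ *-assoc (2 ^ 60) (2 ^ 60) (n ^ 34) ⟨
          2 ^ 120 * n ^ 34                 ≤⟨ *-monoˡ-≤ (n ^ 34) n₀≤n ⟩
          n ^ 35                           <⟨ n³⁵<M⁶⁰ ⟩
          M ^ 60                           ≤⟨ ^-monoˡ-≤ 60 M≤2N ⟩
          (2 * N) ^ 60                     ≡⟨ ^-distribʳ-* 2 N 60 ⟩
          2 ^ 60 * N ^ 60                  ∎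

  n⁷<[1+N]¹²⇒N≢0 : ∀ {n N} .{{_ : NonZero n}} → n ^ 7 < suc N ^ 12 → NonZero N
  n⁷<[1+N]¹²⇒N≢0 {n} {zero}  n⁷<1 = contradiction n⁷<1 (≤⇒≯ (m^n>0 n 7))
  n⁷<[1+N]¹²⇒N≢0 {n} {suc N} _    = _

  1+n≤2*n : ∀ n → .{{NonZero n}} → suc n ≤ 2 * n
  1+n≤2*n (suc n) = s≤s (≤-trans (m≤m+n (suc n) 0) (m≤n+m (suc n + 0) n))

  *-bound⇒^-bound : ∀ m {N c d b n} .{{_ : NonZero N}} → N * d ≤ c * b → c ^ m * n ≤ N ^ m → d ^ m * n ≤ b ^ m
  *-bound⇒^-bound m {N} {c} {d} {b} {n} Nd≤cb cᵐn≤Nᵐ = *-cancelˡ-≤ (N ^ m) {{m^n≢0 N m}} (begin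
    N ^ m * (d ^ m * n)       ≡⟨ *-assoc (N ^ m) (d ^ m) n ⟨
    N ^ m * d ^ m * n         ≡⟨ cong (_* n) (^-distribʳ-* N d m) ⟨
    (N * d) ^ m * n           ≤⟨ *-monoˡ-≤ n (^-monoˡ-≤ m Nd≤cb) ⟩
    (c * b) ^ m * n           ≡⟨ cong (_* n) (^-distribʳ-* c b m) ⟩
    c ^ m * b ^ m * n         ≡⟨ xy∙z≈xz∙y (c ^ m) (b ^ m) n ⟩
    c ^ m * n * b ^ m         ≤⟨ *-monoˡ-≤ (b ^ m) cᵐn≤Nᵐ ⟩
    N ^ m * b ^ m             ∎)
    where open ≤-Reasoning

module Probability where
  open Counting using (∑; 𝟙; countMats; countRow≤length; countMat-concat; hasSize; countMats-hasSize-pos)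
  open import Data.Nat as ℕ using (ℕ; zero; suc; _∸_)
  import Data.Nat.Properties as ℕ
  open import Data.Bool.Properties using (∧-conicalʳ)
  open import Data.Integer as ℤ using (+_)
  import Data.Integer.Tactic.RingSolver as ℤ-Solver
  open import Data.Rational
    using (ℚ; 0ℚ; 1ℚ; _+_; _*_; _-_; -_; 1/_; _÷_; _≤_; _<_; toℚᵘ; Positive; NonNegative; NonZero; positive; ≢-nonZero)
  open import Data.Rational.Properties
  import Data.Rational.Unnormalised as ℚᵘ
  import Data.Rational.Unnormalised.Properties as ℚᵘ
  open import Data.Rational.Solver using (module +-*-Solver)
  open import Algebra.Bundles using (Ring; CommutativeRing)
  open import Algebra.Properties.Semiring.Mult (Ring.semiring +-*-ring) using (_×_; ×-homo-+; ×1-homo-*)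
  open +-*-Solver using (solve; _:+_; _:*_; :-_; _:=_; con)
  import Algebra.Properties.CommutativeSemigroup as CommSemigroupProperties

  module *-CS = CommSemigroupProperties (CommutativeRing.*-commutativeSemigroup +-*-commutativeRing)

  fromℕ : ℕ → ℚ
  fromℕ n = n × 1ℚ

  fromℕ-^ : ∀ a m → fromℕ (a ℕ.^ m) ≡ fromℕ a ^ℚ m
  fromℕ-^ a zero    = refl
  fromℕ-^ a (suc m) = trans (×1-homo-* a (a ℕ.^ m)) (cong (fromℕ a *_) (fromℕ-^ a m))

  fromℕ-nonNeg : ∀ a → NonNegative (fromℕ a)
  fromℕ-nonNeg zero    = _
  fromℕ-nonNeg (suc a) = nonNeg+nonNeg⇒nonNeg 1ℚ (fromℕ a) {{fromℕ-nonNeg a}}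

  fromℕ-pos : ∀ {a} → 1 ℕ.≤ a → Positive (fromℕ a)
  fromℕ-pos {suc a} _ = pos+nonNeg⇒pos 1ℚ (fromℕ a) {{fromℕ-nonNeg a}}

  fromℕ-mono-≤ : ∀ {a b} → a ℕ.≤ b → fromℕ a ≤ fromℕ b
  fromℕ-mono-≤ {a} {b} a≤b = begin
    fromℕ a                   ≡⟨ +-identityʳ (fromℕ a) ⟨
    fromℕ a + 0ℚ              ≤⟨ +-monoʳ-≤ (fromℕ a) (nonNegative⁻¹ (fromℕ (b ∸ a)) {{fromℕ-nonNeg (b ∸ a)}}) ⟩
    fromℕ a + fromℕ (b ∸ a)   ≡⟨ ×-homo-+ 1ℚ a (b ∸ a) ⟨
    fromℕ (a ℕ.+ (b ∸ a))     ≡⟨ cong fromℕ (ℕ.m+[n∸m]≡n a≤b) ⟩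
    fromℕ b                   ∎
    where open ≤-Reasoning

  fromℕ-toℚᵘ : ∀ n → toℚᵘ (fromℕ n) ℚᵘ.≃ ℚᵘ.mkℚᵘ (+ n) 0
  fromℕ-toℚᵘ zero    = ℚᵘ.≃-refl
  fromℕ-toℚᵘ (suc n) = ℚᵘ.≃-trans (toℚᵘ-homo-+ 1ℚ (fromℕ n))
    (ℚᵘ.≃-trans (ℚᵘ.+-congʳ (toℚᵘ 1ℚ) (fromℕ-toℚᵘ n)) (ℚᵘ.*≡* (identity (+ n))))
    where
    identity : ∀ x → (+ 1 ℤ.* + 1 ℤ.+ x ℤ.* + 1) ℤ.* + 1 ≡ (+ 1 ℤ.+ x) ℤ.* (+ 1 ℤ.* + 1)
    identity = ℤ-Solver.solve-∀

  fromℕ*invN : ∀ n → .{{_ : ℕ.NonZero n}} → fromℕ n * invN n ≡ 1ℚ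
  fromℕ*invN (suc n) = toℚᵘ-injective (ℚᵘ.≃-trans (toℚᵘ-homo-* (fromℕ (suc n)) (invN (suc n)))
    (ℚᵘ.≃-trans (ℚᵘ.*-cong (fromℕ-toℚᵘ (suc n)) (toℚᵘ-fromℚᵘ (ℚᵘ.mkℚᵘ (+ 1) n)))
                (ℚᵘ.*≡* (identity (+ suc n)))))
    where
    identity : ∀ x → (x ℤ.* + 1) ℤ.* + 1 ≡ + 1 ℤ.* (+ 1 ℤ.* x)
    identity = ℤ-Solver.solve-∀

  ^ℚ-pos : ∀ x → .{{Positive x}} → ∀ m → Positive (x ^ℚ m)
  ^ℚ-pos x zero    = _
  ^ℚ-pos x (suc m) = pos*pos⇒pos x (x ^ℚ m) {{^ℚ-pos x m}}

  *-distrib-^ℚ : ∀ x y m → (x * y) ^ℚ m ≡ x ^ℚ m * y ^ℚ m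
  *-distrib-^ℚ x y zero    = refl
  *-distrib-^ℚ x y (suc m) =
    trans (cong ((x * y) *_) (*-distrib-^ℚ x y m)) (*-CS.interchange x y (x ^ℚ m) (y ^ℚ m))

  module _ (p : ℚ) where

    entryWeight : Bool → ℚ
    entryWeight b = if b then p else 1ℚ - p

    rowWeight : ∀ {L} → Vec Bool L → ℚ
    rowWeight = Vec.foldr _ (λ b w → entryWeight b * w) 1ℚ

    matWeight : ∀ {m n} → Vec (Vec Bool n) m → ℚ
    matWeight = Vec.foldr _ (λ r w → rowWeight r * w) 1ℚ

    rowWeight-++ : ∀ {a b} (u : Vec Bool a) (v : Vec Bool b) → rowWeight (u Vec.++ v) ≡ rowWeight u * rowWeight v
    rowWeight-++ []      v = sym (*-identityˡ (rowWeight v))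
    rowWeight-++ (x ∷ u) v =
      trans (cong (entryWeight x *_) (rowWeight-++ u v)) (sym (*-assoc (entryWeight x) (rowWeight u) (rowWeight v)))

    matWeight-concat : ∀ {m n} (Q : Vec (Vec Bool n) m) → matWeight Q ≡ rowWeight (concat Q)
    matWeight-concat []      = refl
    matWeight-concat (r ∷ Q) = trans (cong (rowWeight r *_) (matWeight-concat Q)) (sym (rowWeight-++ r (concat Q)))

    rowWeight-countRow : ∀ {L} (v : Vec Bool L) → rowWeight v ≡ p ^ℚ countRow v * (1ℚ - p) ^ℚ (L ∸ countRow v)
    rowWeight-countRow []          = sym (*-identityʳ 1ℚ)
    rowWeight-countRow (true ∷ v)  = trans (cong (p *_) (rowWeight-countRow v)) (sym (*-assoc p _ _))
    rowWeight-countRow {suc L} (false ∷ v) = begin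
      q * rowWeight v               ≡⟨ cong (q *_) (rowWeight-countRow v) ⟩
      q * (p ^ℚ c * q ^ℚ (L ∸ c))   ≡⟨ *-CS.x∙yz≈y∙xz q (p ^ℚ c) (q ^ℚ (L ∸ c)) ⟩
      p ^ℚ c * q ^ℚ suc (L ∸ c)     ≡⟨ cong (λ e → p ^ℚ c * q ^ℚ e) (ℕ.+-∸-assoc 1 (countRow≤length v)) ⟨
      p ^ℚ c * q ^ℚ (suc L ∸ c)     ∎
      where
      open ≡-Reasoning
      q = 1ℚ - p
      c = countRow v

    weight-size : ∀ {N} (Q : Mat N) → weight p Q ≡ p ^ℚ size Q * (1ℚ - p) ^ℚ (N ℕ.* N ∸ size Q)
    weight-size Q = trans (matWeight-concat Q) (trans (rowWeight-countRow (concat Q))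
      (cong (λ s → p ^ℚ s * (1ℚ - p) ^ℚ (_ ∸ s)) (sym (countMat-concat Q))))

    prob-uniform : ∀ N (E : Mat N → Bool) w → (∀ Q → E Q ≡ true → weight p Q ≡ w) →
                   prob N p E ≡ fromℕ (countMats N E) * w
    prob-uniform N E w E⇒weight≡w = go (allMats N)
      where
      go : (xs : List (Mat N)) →
           foldr (λ Q acc → (if E Q then weight p Q else 0ℚ) + acc) 0ℚ xs ≡ fromℕ (∑ xs (𝟙 ∘ E)) * w
      go []       = sym (*-zeroˡ w)
      go (Q ∷ xs) with E Q in EQ
      ... | true  = trans (cong₂ _+_ (E⇒weight≡w Q EQ) (go xs))
                          (solve 2 (λ w s → w :+ s :* w := (con 1ℚ :+ s) :* w) refl w (fromℕ (∑ xs (𝟙 ∘ E))))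
      ... | false = trans (+-identityˡ _) (go xs)

  ÷-cancel-common : ∀ x y w → .{{_ : NonZero (y * w)}} → ((x * w) ÷ (y * w)) * y ≡ x
  ÷-cancel-common x y w = begin
    x * w * 1/ (y * w) * y
      ≡⟨ solve 4 (λ x y w i → x :* w :* i :* y := x :* (y :* w :* i)) refl x y w (1/ (y * w)) ⟩
    x * (y * w * 1/ (y * w))
      ≡⟨ cong (x *_) (*-inverseʳ (y * w)) ⟩
    x * 1ℚ
      ≡⟨ *-identityʳ x ⟩
    x ∎
    where open ≡-Reasoning

  condProb-uniform : ∀ N p (A B : Mat N → Bool) w → .{{Positive w}} →
    (∀ Q → B Q ≡ true → weight p Q ≡ w) → 1 ℕ.≤ countMats N B →
    condProb N p A B * fromℕ (countMats N B) ≡ fromℕ (countMats N (λ Q → A Q ∧ B Q))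
  condProb-uniform N p A B w B⇒weight≡w 1≤b with prob N p B ≟ 0ℚ
  ... | yes P[B]≡0 = contradiction (trans (sym P[B]) P[B]≡0) P[B]≢0
    where
    instance
      b-pos : Positive (fromℕ (countMats N B))
      b-pos = fromℕ-pos 1≤b
    P[B]≢0 : fromℕ (countMats N B) * w ≢ 0ℚ
    P[B]≢0 eq = <-irrefl (sym eq) (positive⁻¹ _ {{pos*pos⇒pos (fromℕ (countMats N B)) w}})
    P[B] : prob N p B ≡ fromℕ (countMats N B) * w
    P[B] = prob-uniform p N B w B⇒weight≡w
  ... | no P[B]≢0 = ratio (prob N p (λ Q → A Q ∧ B Q)) (prob N p B)
                          (prob-uniform p N _ w (λ Q → B⇒weight≡w Q ∘ ∧-conicalʳ (A Q) (B Q)))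
                          (prob-uniform p N B w B⇒weight≡w) {{≢-nonZero P[B]≢0}}
    where
    ratio : ∀ u v → u ≡ fromℕ (countMats N (λ Q → A Q ∧ B Q)) * w → v ≡ fromℕ (countMats N B) * w →
            .{{_ : NonZero v}} → (u ÷ v) * fromℕ (countMats N B) ≡ fromℕ (countMats N (λ Q → A Q ∧ B Q))
    ratio _ _ refl refl = ÷-cancel-common _ _ w

  invN-pos : ∀ n → .{{_ : ℕ.NonZero n}} → Positive (invN n)
  invN-pos n = normalize-pos 1 n

  invN<1 : ∀ n → .{{_ : ℕ.NonZero n}} → 2 ℕ.≤ n → invN n < 1ℚ
  invN<1 (suc zero)    (ℕ.s≤s ())
  invN<1 (suc (suc m)) _ = begin-strict
    invN n                 ≡⟨ *-identityʳ (invN n) ⟨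
    invN n * 1ℚ            <⟨ *-monoʳ-<-pos (invN n) {{invN-pos n}} 1<n ⟩
    invN n * fromℕ n       ≡⟨ *-comm (invN n) (fromℕ n) ⟩
    fromℕ n * invN n       ≡⟨ fromℕ*invN n ⟩
    1ℚ                     ∎
    where
    open ≤-Reasoning
    n = suc (suc m)
    1<n : 1ℚ < fromℕ n
    1<n = begin-strict
      1ℚ                     ≡⟨ +-identityʳ 1ℚ ⟨
      1ℚ + 0ℚ                <⟨ +-monoʳ-< 1ℚ (positive⁻¹ (fromℕ (suc m)) {{fromℕ-pos {suc m} (ℕ.s≤s ℕ.z≤n)}}) ⟩
      1ℚ + fromℕ (suc m)     ∎

  ≤-invN : ∀ x n → .{{_ : ℕ.NonZero n}} → x * fromℕ n ≤ 1ℚ → x ≤ invN n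
  ≤-invN x n x*n≤1 = begin
    x                       ≡⟨ *-identityʳ x ⟨
    x * 1ℚ                  ≡⟨ cong (x *_) (fromℕ*invN n) ⟨
    x * (fromℕ n * invN n)  ≡⟨ *-assoc x (fromℕ n) (invN n) ⟨
    x * fromℕ n * invN n    ≤⟨ *-monoʳ-≤-nonNeg (invN n) {{pos⇒nonNeg (invN n) {{invN-pos n}}}} x*n≤1 ⟩
    1ℚ * invN n             ≡⟨ *-identityˡ (invN n) ⟩
    invN n                  ∎
    where open ≤-Reasoning

  complement-ratio : ∀ P a d b → a ℕ.+ d ≡ b → P * fromℕ b ≡ fromℕ a → (1ℚ - P) * fromℕ b ≡ fromℕ d
  complement-ratio P a d _ refl P*b≡a = begin
    (1ℚ - P) * fromℕ (a ℕ.+ d)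
      ≡⟨ solve 2 (λ P b → (con 1ℚ :+ (:- P)) :* b := b :+ (:- (P :* b))) refl P (fromℕ (a ℕ.+ d)) ⟩
    fromℕ (a ℕ.+ d) - P * fromℕ (a ℕ.+ d)
      ≡⟨ cong₂ _-_ (×-homo-+ 1ℚ a d) P*b≡a ⟩
    (fromℕ a + fromℕ d) - fromℕ a
      ≡⟨ solve 2 (λ a d → (a :+ d) :+ (:- a) := d) refl (fromℕ a) (fromℕ d) ⟩
    fromℕ d ∎
    where open ≡-Reasoning

  ratio^m*n≤1 : ∀ x b d n m → 1 ℕ.≤ b → x * fromℕ b ≡ fromℕ d → d ℕ.^ m ℕ.* n ℕ.≤ b ℕ.^ m →
                  x ^ℚ m * fromℕ n ≤ 1ℚ
  ratio^m*n≤1 x b d n m 1≤b x*b≡d dᵐn≤bᵐ =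
    *-cancelʳ-≤-pos (fromℕ (b ℕ.^ m)) {{fromℕ-pos (ℕ.m^n>0 b {{ℕ.>-nonZero 1≤b}} m)}} (begin
    x ^ℚ m * fromℕ n * fromℕ (b ℕ.^ m)       ≡⟨ cong (x ^ℚ m * fromℕ n *_) (fromℕ-^ b m) ⟩
    x ^ℚ m * fromℕ n * fromℕ b ^ℚ m          ≡⟨ *-CS.xy∙z≈xz∙y (x ^ℚ m) (fromℕ n) (fromℕ b ^ℚ m) ⟩
    x ^ℚ m * fromℕ b ^ℚ m * fromℕ n          ≡⟨ cong (_* fromℕ n) (*-distrib-^ℚ x (fromℕ b) m) ⟨
    (x * fromℕ b) ^ℚ m * fromℕ n             ≡⟨ cong (λ y → y ^ℚ m * fromℕ n) x*b≡d ⟩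
    fromℕ d ^ℚ m * fromℕ n                   ≡⟨ cong (_* fromℕ n) (fromℕ-^ d m) ⟨
    fromℕ (d ℕ.^ m) * fromℕ n                ≡⟨ ×1-homo-* (d ℕ.^ m) n ⟨
    fromℕ (d ℕ.^ m ℕ.* n)                    ≤⟨ fromℕ-mono-≤ dᵐn≤bᵐ ⟩
    fromℕ (b ℕ.^ m)                          ≡⟨ *-identityˡ _ ⟨
    1ℚ * fromℕ (b ℕ.^ m)                     ∎)
    where open ≤-Reasoning

  1-invN-pos : ∀ n → .{{_ : ℕ.NonZero n}} → 2 ℕ.≤ n → Positive (1ℚ - invN n)
  1-invN-pos n 2≤n = positive (begin-strict
    0ℚ                ≡⟨ +-inverseʳ (invN n) ⟨
    invN n - invN n   <⟨ +-monoˡ-< (- invN n) (invN<1 n 2≤n) ⟩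
    1ℚ - invN n       ∎)
    where open ≤-Reasoning

  weight-hasSize : ∀ p {N k} (Q : Mat N) → hasSize N k Q ≡ true →
                   weight p Q ≡ p ^ℚ k * (1ℚ - p) ^ℚ (N ℕ.* N ∸ k)
  weight-hasSize p {N} {k} Q size≡k = trans (weight-size p Q)
    (cong (λ s → p ^ℚ s * (1ℚ - p) ^ℚ (N ℕ.* N ∸ s)) (ℕ.≡ᵇ⇒≡ (size Q) k (subst T (sym size≡k) _)))

  condProb-hasSize : ∀ n .{{_ : ℕ.NonZero n}} → 2 ℕ.≤ n → ∀ N k → k ℕ.≤ N ℕ.* N → (E : Mat N → Bool) →
    condProb N (invN n) E (hasSize N k) * fromℕ (countMats N (hasSize N k)) ≡
    fromℕ (countMats N (λ Q → E Q ∧ hasSize N k Q))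
  condProb-hasSize n 2≤n N k k≤N² E =
    condProb-uniform N p E (hasSize N k) _ {{w-pos}} (weight-hasSize p) (countMats-hasSize-pos N k k≤N²)
    where
    p : ℚ
    p = invN n
    w-pos : Positive (p ^ℚ k * (1ℚ - p) ^ℚ (N ℕ.* N ∸ k))
    w-pos = pos*pos⇒pos (p ^ℚ k) {{^ℚ-pos p {{invN-pos n}} k}}
                        _ {{^ℚ-pos (1ℚ - p) {{1-invN-pos n 2≤n}} (N ℕ.* N ∸ k)}}

  complement-^-bound : ∀ P a d b n m → .{{_ : ℕ.NonZero n}} → a ℕ.+ d ≡ b → 1 ℕ.≤ b →
                       P * fromℕ b ≡ fromℕ a → d ℕ.^ m ℕ.* n ℕ.≤ b ℕ.^ m → (1ℚ - P) ^ℚ m ≤ invN n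
  complement-^-bound P a d b n m a+d≡b 1≤b P*b≡a dᵐn≤bᵐ = ≤-invN ((1ℚ - P) ^ℚ m) n
    (ratio^m*n≤1 (1ℚ - P) b d n m 1≤b (complement-ratio P a d b a+d≡b P*b≡a) dᵐn≤bᵐ)

open import Data.Nat using (ℕ; suc; _^_; _≤_; _<_; NonZero; _≡ᵇ_)
import Data.Nat as ℕ
import Data.Nat.Properties as ℕ
open import Data.Product using (∃; _,_)
open import Data.Sum using (inj₂)
open import Data.Rational using (ℚ)
open Counting using (hasSize; countMats; countMats-split; countMats-hasSize-pos; bad-count-bound)
open Exponents using (n⁷<[1+N]¹²⇒N≢0; k<M; sixth-power-bound; 1+n≤2*n; *-bound⇒^-bound)
open Probability using (condProb-hasSize; complement-^-bound)

lemma3p6 : ∃ λ n₀ → (n : ℕ) → .{{_ : NonZero n}} → n₀ ≤ n →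
             (N : ℕ) → N ^ 12 ≤ n ^ 7 → n ^ 7 < suc N ^ 12 →
             (k : ℕ) → k ^ 5 ≤ n →
             GeOneMinusInvSixthRoot
               (condProb N (invN n) eventQ (λ Q → size Q ≡ᵇ k)) n
lemma3p6 = 2 ^ 120 , large-n
  where
  large-n : (n : ℕ) → .{{_ : NonZero n}} → 2 ^ 120 ≤ n → (N : ℕ) → N ^ 12 ≤ n ^ 7 → n ^ 7 < suc N ^ 12 →
            (k : ℕ) → k ^ 5 ≤ n → GeOneMinusInvSixthRoot (condProb N (invN n) eventQ (hasSize N k)) n
  large-n n n₀≤n N _ n⁷<[1+N]¹² k k⁵≤n =
    inj₂ (complement-^-bound P a d b n 6 (countMats-split N eventQ (hasSize N k)) (countMats-hasSize-pos N k k≤N²)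
            (condProb-hasSize n 2≤n N k k≤N² eventQ) d⁶n≤b⁶)
    where
    instance
      N≢0 : NonZero N
      N≢0 = n⁷<[1+N]¹²⇒N≢0 n⁷<[1+N]¹²
    P : ℚ
    P = condProb N (invN n) eventQ (hasSize N k)
    a d b : ℕ
    a = countMats N (λ Q → eventQ Q ∧ hasSize N k Q)
    d = countMats N (λ Q → not (eventQ Q) ∧ hasSize N k Q)
    b = countMats N (hasSize N k)
    k≤N : k ≤ N
    k≤N = ℕ.s≤s⁻¹ (k<M n⁷<[1+N]¹² {k} k⁵≤n)
    k≤N² : k ≤ N ℕ.* N
    k≤N² = ℕ.≤-trans k≤N (ℕ.m≤m*n N N)
    2≤n : 2 ≤ n
    2≤n = ℕ.≤-trans (ℕ.≤ᵇ⇒≤ 2 (2 ^ 120) _) n₀≤n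
    d⁶n≤b⁶ : d ^ 6 ℕ.* n ≤ b ^ 6
    d⁶n≤b⁶ = *-bound⇒^-bound 6 {N} {k ℕ.* k ℕ.+ k ℕ.* k} (bad-count-bound N k k≤N)
               (ℕ.<⇒≤ (sixth-power-bound n⁷<[1+N]¹² {k} k⁵≤n {N} n₀≤n (1+n≤2*n N)))
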